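{- Let $G=(V_G,E_G)$ be a digraph and let $H=(V_H,E_H)$ be an induced subdigraph of $G$ such that no vertex of $H$ that is not a source of $H$ has a predecessor in $V_G\setminus V_H$. If $A'$ is a feasible solution for SSGW on $G$, then $A'\cap V_H$ is a feasible solution for SSGW on $H$.
   Context: Vertices carry positive integer sizes and there is a positive integer capacity $c$ (the same for $G$ and $H$). A source of $H$ is a vertex with indegree $0$ in $H$. A subset $A'$ of the vertex set of a digraph $D$ is a feasible solution for SSGW on $D$ if the sum of the sizes of vertices in $A'$ is at most $c$ and for every vertex $y$ of $D$, if $y$ has at least one predecessor in $D$ and all predecessors of $y$ in $D$ lie in $A'$, then $y\in A'$. -}

module Defs where

open import Data.Nat using (ℕ; _≤_)
open import Data.Fin using (Fin)
open import Data.Fin.Subset using (Subset; _∈_)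
open import Data.Fin.Subset.Properties using (_∈?_)
open import Data.Product using (∃; _×_)
open import Data.Empty using (⊥)
open import Data.List using (map; filter; allFin)
open import Data.Nat.ListAction using (sum)
open import Data.Vec using (lookup; tabulate)
open import Relation.Binary.PropositionalEquality using (_≡_)
open import Function.Definitions using (Injective)

record Digraph : Set₁ where
  field
    n   : ℕ
    Arc : Fin n → Fin n → Set

open Digraph public

sizeSum : ∀ {k} → (Fin k → ℕ) → Subset k → ℕ
sizeSum {k} s A = sum (map s (filter (_∈? A) (allFin k)))

HasPred : (D : Digraph) → Fin (n D) → Set
HasPred D y = ∃ λ x → Arc D x y

AllPredIn : (D : Digraph) → Subset (n D) → Fin (n D) → Set
AllPredIn D A y = ∀ x → Arc D x y → x ∈ A

Feasible : (D : Digraph) → (Fin (n D) → ℕ) → ℕ → Subset (n D) → Set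
Feasible D s c A =
  (sizeSum s A ≤ c) ×
  (∀ y → HasPred D y → AllPredIn D A y → y ∈ A)

-- H is an induced subdigraph of G via the injective vertex embedding ι
-- (V_H is identified with the image of ι).
IsInducedVia : (H G : Digraph) → (Fin (n H) → Fin (n G)) → Set
IsInducedVia H G ι =
  Injective _≡_ _≡_ ι ×
  (∀ x y → (Arc H x y → Arc G (ι x) (ι y)) × (Arc G (ι x) (ι y) → Arc H x y))

IsSource : (H : Digraph) → Fin (n H) → Set
IsSource H y = ∀ x → Arc H x y → ⊥

InImage : ∀ {m k} → (Fin m → Fin k) → Fin k → Set
InImage ι v = ∃ λ i → ι i ≡ v

-- A' ∩ V_H, as a subset of V_H (pulled back along ι)
restrict : ∀ {m k} → (Fin m → Fin k) → Subset k → Subset m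
restrict ι A = tabulate (λ i → lookup A (ι i))

-- The vertices of restrict ι A' are mapped by the injective ι
--    onto distinct vertices of A', so their total size is at most that of A'.
--
-- If y has a predecessor in H, then y is not a source of H, so
--    by hypothesis every G-predecessor of ι y is some ι x; as H is induced,
--    x is an H-predecessor of y.  Hence "all H-predecessors of y lie in
--    restrict ι A'" lifts to "all G-predecessors of ι y lie in A'", and the
--    closure of A' in G puts ι y, i.e. y, into the restriction.
module Submission where

open import Defs
open import Data.Nat using (ℕ; _≤_; _+_; z≤n)
open import Data.Nat.Properties using (≤-trans; +-monoʳ-≤)
open import Data.Nat.ListAction using (sum)
open import Data.Nat.ListAction.Properties using (sum-↭)
open import Data.Fin using (Fin)
open import Data.Fin.Subset using (Subset) renaming (_∈_ to _∈ˢ_)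
open import Data.Fin.Subset.Properties using (_∈?_)
open import Data.Empty using (⊥-elim)
open import Data.Sum using (inj₁; inj₂)
open import Data.Product using (_,_; proj₁; proj₂)
open import Data.List using (List; []; _∷_; [_]; _++_; map; filter; allFin)
open import Data.List.Properties using (map-∘)
open import Data.List.Relation.Unary.Any using (here; there)
import Data.List.Relation.Unary.All as All
open import Data.List.Relation.Unary.AllPairs using (_∷_)
open import Data.List.Relation.Unary.Unique.Propositional using (Unique)
import Data.List.Relation.Unary.Unique.Propositional.Properties as Unique
open import Data.List.Membership.Propositional using (_∈_)
open import Data.List.Membership.Propositional.Properties
  using (∈-++⁺ˡ; ∈-++⁺ʳ; ∈-++⁻; ∈-∃++; ∈-map⁻; ∈-filter⁺; ∈-filter⁻; ∈-allFin)
import Data.List.Relation.Binary.Permutation.Propositional.Properties as Perm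
import Data.Vec
open import Data.Vec.Properties using ([]=⇒lookup; lookup⇒[]=; lookup∘tabulate)
open import Function.Definitions using (Injective)
open import Relation.Nullary using (¬_)
open import Relation.Binary.PropositionalEquality
  using (_≡_; _≢_; refl; sym; trans; cong; subst)

module _ {m k : ℕ} (ι : Fin m → Fin k) (A : Subset k) where

  restrict-lookup : ∀ i → Data.Vec.lookup (restrict ι A) i ≡ Data.Vec.lookup A (ι i)
  restrict-lookup = lookup∘tabulate (λ j → Data.Vec.lookup A (ι j))

  ∈-restrict⁻ : ∀ {i} → i ∈ˢ restrict ι A → ι i ∈ˢ A
  ∈-restrict⁻ {i} i∈ =
    lookup⇒[]= (ι i) A (trans (sym (restrict-lookup i)) ([]=⇒lookup i∈))

  ∈-restrict⁺ : ∀ {i} → ι i ∈ˢ A → i ∈ˢ restrict ι A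
  ∈-restrict⁺ {i} ιi∈ =
    lookup⇒[]= i (restrict ι A) (trans (restrict-lookup i) ([]=⇒lookup ιi∈))

module _ {A : Set} (w : A → ℕ) where

  sum-extract : ∀ (h t : List A) x →
    sum (map w (h ++ [ x ] ++ t)) ≡ w x + sum (map w (h ++ t))
  sum-extract h t x = sum-↭ (Perm.map⁺ w (Perm.shift x h t))

  ∈-extract : ∀ (h t : List A) {x y} → y ∈ h ++ [ x ] ++ t → y ≢ x → y ∈ h ++ t
  ∈-extract h t y∈ y≢x with ∈-++⁻ h y∈
  ... | inj₁ y∈h               = ∈-++⁺ˡ y∈h
  ... | inj₂ (here y≡x)        = ⊥-elim (y≢x y≡x)
  ... | inj₂ (there y∈t)       = ∈-++⁺ʳ h y∈t

  sum-mono-⊆ : ∀ {xs ys : List A} → Unique xs → (∀ {y} → y ∈ xs → y ∈ ys) →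
    sum (map w xs) ≤ sum (map w ys)
  sum-mono-⊆ {[]}     _            _  = z≤n
  sum-mono-⊆ {x ∷ xs} (x∉xs ∷ uniq) xs⊆ys
    with h , t , refl ← ∈-∃++ (xs⊆ys (here refl))
    rewrite sum-extract h t x =
    +-monoʳ-≤ (w x) (sum-mono-⊆ uniq λ y∈xs →
      ∈-extract h t (xs⊆ys (there y∈xs)) (λ y≡x → All.lookup x∉xs y∈xs (sym y≡x)))

sizeSum-restrict : ∀ {m k} (ι : Fin m → Fin k) → Injective _≡_ _≡_ ι →
  (s : Fin k → ℕ) (A : Subset k) →
  sizeSum (λ i → s (ι i)) (restrict ι A) ≤ sizeSum s A
sizeSum-restrict {m} {k} ι ι-inj s A =
  subst (_≤ sizeSum s A) (sym (cong sum (map-∘ membersH)))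
    (sum-mono-⊆ s (Unique.map⁺ ι-inj membersH-unique) image⊆membersG)
  where
  membersH : List (Fin m)
  membersH = filter (_∈? restrict ι A) (allFin m)

  membersH-unique : Unique membersH
  membersH-unique = Unique.filter⁺ (_∈? restrict ι A) (Unique.allFin⁺ m)

  image⊆membersG : ∀ {v} → v ∈ map ι membersH → v ∈ filter (_∈? A) (allFin k)
  image⊆membersG v∈ with i , i∈ , refl ← ∈-map⁻ ι v∈ =
    ∈-filter⁺ (_∈? A) (∈-allFin (ι i))
      (∈-restrict⁻ ι A (proj₂ (∈-filter⁻ (_∈? restrict ι A) {xs = allFin m} i∈)))

allPredIn-lift : (G H : Digraph) (ι : Fin (n H) → Fin (n G)) (A : Subset (n G)) →
  IsInducedVia H G ι →
  (∀ (y : Fin (n H)) → ¬ IsSource H y →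
    ∀ (x : Fin (n G)) → Arc G x (ι y) → InImage ι x) →
  ∀ y → HasPred H y → AllPredIn H (restrict ι A) y → AllPredIn G A (ι y)
allPredIn-lift G H ι A (_ , induced) noOutsidePred y (x , x→y) allPredH v v→ιy
  with i , refl ← noOutsidePred y (λ y-source → y-source x x→y) v v→ιy =
  ∈-restrict⁻ ι A (allPredH i (proj₂ (induced i y) v→ιy))

lemma8 : (G H : Digraph) (ι : Fin (n H) → Fin (n G))
    (s : Fin (n G) → ℕ) (c : ℕ) (A' : Subset (n G)) →
    IsInducedVia H G ι →
    (∀ (y : Fin (n H)) → ¬ IsSource H y →
    ∀ (x : Fin (n G)) → Arc G x (ι y) → InImage ι x) →
    Feasible G s c A' →
    Feasible H (λ i → s (ι i)) c (restrict ι A')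
lemma8 G H ι s c A' induced noOutsidePred (withinCapacity , closed) =
  ≤-trans (sizeSum-restrict ι (proj₁ induced) s A') withinCapacity ,
  λ y hasPred allPredH →
    ∈-restrict⁺ ι A'
      (closed (ι y) (lift-arc hasPred) (allPredIn-lift G H ι A' induced noOutsidePred y hasPred allPredH))
  where
  lift-arc : ∀ {y} → HasPred H y → HasPred G (ι y)
  lift-arc {y} (x , x→y) = ι x , proj₁ (proj₂ induced x y) x→y
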